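{- Let $d\ge 2$ and $k,m,n_0\in\mathbf{N}$. Then $$f(mn_0,k,d)\le (k-1)^d\, f(n_0,k,d)+d\,n_0\,m^{d}\binom{m}{k}\, f(n_0,k,d-1).$$
   Context: A $d$-dimensional 0-1 matrix is a tuple $(M;n_1,\dots,n_d)$ with $M\subset[n_1]\times\dots\times[n_d]$. $F=(F;k_1,\dots,k_d)$ is contained in $M=(M;n_1,\dots,n_d)$ if there are increasing injections $f_i:[k_i]\to[n_i]$ for $i=1,\dots,d$ such that $(f_1(x_1),\dots,f_d(x_d))\in M$ for every $(x_1,\dots,x_d)\in F$. Otherwise $M$ avoids $F$. $f(n,F,d)$ is the maximum of $|M|$ over all $d$-dimensional matrices $(M;n,\dots,n)$ that avoid $F$. A $d$-dimensional permutation of $[k]$ is a $d$-dimensional matrix $P=(P;k,\dots,k)$ such that for every $i\in[d]$ and every $x\in[k]$ there is exactly one edge $e\in P$ whose $i$-th coordinate equals $x$. For $d=1$ the only such permutation is $([k];k)$. Finally, $f(n,k,d)=\max_P f(n,P,d)$, where the maximum is over all $d$-dimensional permutations $P$ of $[k]$. -}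

module Defs where

open import Data.Nat using (ℕ)
open import Data.Fin as Fin using (Fin)
open import Data.Vec using (Vec; lookup; tabulate)
open import Data.List using (List; length)
open import Data.List.Membership.Propositional using (_∈_)
open import Data.List.Relation.Unary.Unique.Propositional using (Unique)
open import Data.Product using (Σ; _×_; ∃; ∃-syntax)
open import Relation.Binary.PropositionalEquality using (_≡_)
open import Relation.Nullary using (¬_)

-- A point of [n]^d (coordinates in Fin n, i.e. [n] shifted to start at 0).
Point : ℕ → ℕ → Set
Point d n = Vec (Fin n) d

-- A d-dimensional 0-1 matrix (M; n,…,n): a duplicate-free list of points of [n]^d.
record Matrix (d n : ℕ) : Set where
  constructor mkMatrix
  field
    entries : List (Point d n)
    unique  : Unique entries
open Matrix public

size : ∀ {d n} → Matrix d n → ℕ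
size M = length (entries M)

Increasing : ∀ {k n} → (Fin k → Fin n) → Set
Increasing g = ∀ a b → a Fin.< b → g a Fin.< g b

Contains : ∀ {d k n} → Matrix d n → Matrix d k → Set
Contains {d} {k} {n} M F =
  Σ (Fin d → Fin k → Fin n) λ g →
    (∀ i → Increasing (g i)) ×
    (∀ x → x ∈ entries F → tabulate (λ i → g i (lookup x i)) ∈ entries M)

Avoids : ∀ {d k n} → Matrix d n → Matrix d k → Set
Avoids M F = ¬ Contains M F

IsPermutation : ∀ {d k} → Matrix d k → Set
IsPermutation {d} {k} P =
  ∀ (i : Fin d) (x : Fin k) →
    (∃[ e ] (e ∈ entries P × lookup e i ≡ x)) ×
    (∀ e e′ → e ∈ entries P → e′ ∈ entries P →
       lookup e i ≡ x → lookup e′ i ≡ x → e ≡ e′)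

-- "v = f(n,k,d)": v is the maximum of |M| over all d-dimensional (M;n,…,n)
-- avoiding some d-dimensional permutation P of [k], taken over all such P
-- (max over P of max over M = max over pairs (P,M)).
IsF : (n k d : ℕ) → ℕ → Set
IsF n k d v =
  (∃[ P ] ∃[ M ] (IsPermutation {d} {k} P × Avoids {d} {k} {n} M P × size M ≡ v)) ×
  (∀ (P : Matrix d k) (M : Matrix d n) → IsPermutation P → Avoids M P → size M Data.Nat.≤ v)

-- Cut [n₀m]^d into n₀^d blocks of side m. Let M avoid the permutation P.
-- The blocks met by M form a matrix on [n₀]^d that still avoids P (a copy
-- of P there lifts to M by choosing one entry in each block), so there are
-- at most f(n₀,k,d) of them. A block in which M occupies at most k-1
-- offsets in every direction holds at most (k-1)^d entries. Any other block
-- is "wide" in some direction i: M occupies k offsets S of it in direction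
-- i. For fixed i, the i-th block coordinate t and S, the wide blocks form a
-- (d-1)-dimensional matrix avoiding P with coordinate i deleted, since the
-- k offsets of S supply the i-th coordinates of a copy of P. Hence at most
-- d n₀ C(m,k) f(n₀,k,d-1) wide blocks, each holding at most m^d entries.
module Submission where

open import Defs
open import Data.Nat using (ℕ; _+_; _*_; _∸_; _^_; _≤_)
open import Data.Nat.Combinatorics using (_C_)

open import Data.Nat as ℕ using (zero; suc; z≤n; s≤s; _≤?_)
open import Data.Nat.Properties
open import Data.Nat.Combinatorics using (nCk+nC[k+1]≡[n+1]C[k+1])
open import Data.Nat.Tactic.RingSolver using (solve-∀)
open import Data.Fin as Fin using (Fin; zero; suc; toℕ; combine; remQuot; punchIn; punchOut)
open import Data.Fin.Properties
  using (all?; ¬∀⟶∃¬; punchIn-punchOut; combine-remQuot; combine-monoˡ-<; toℕ-combine)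
  renaming (_≟_ to _≟ᶠ_)
open import Data.Vec as Vec using (Vec; []; _∷_; lookup; tabulate; insertAt; removeAt; zipWith)
open import Data.Vec.Properties
  using (≡-dec; lookup-map; lookup∘tabulate; tabulate∘lookup; tabulate-cong;
         insertAt-lookup; insertAt-punchIn; insertAt-removeAt; removeAt-punchOut)
open import Data.List as List
  using (List; []; _∷_; [_]; length; _++_; concatMap; filter; allFin; deduplicate; take)
open import Data.List.Properties
  using (length-++; length-map; length-tabulate; length-take; take-all; length-removeAt′)
open import Data.List.Membership.Propositional using (_∈_; find; lose)
open import Data.List.Membership.Propositional.Properties
  using (∈-map⁺; ∈-map⁻; ∈-++⁺ˡ; ∈-++⁺ʳ; ∈-++⁻; ∈-concatMap⁺; ∈-filter⁺;
         ∈-filter⁻; ∈-deduplicate⁺; ∈-deduplicate⁻; ∈-allFin)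
open import Data.List.Relation.Binary.Subset.Propositional using (_⊆_)
open import Data.List.Relation.Unary.Any using (Any; here; there; any?; index; _─_)
open import Data.List.Relation.Unary.All as All using ()
open import Data.List.Relation.Unary.AllPairs using (AllPairs; []; _∷_)
open import Data.List.Relation.Unary.AllPairs.Properties using (tabulate⁺-<)
open import Data.List.Relation.Unary.Unique.Propositional using (Unique)
open import Data.List.Relation.Unary.Unique.DecPropositional.Properties using (deduplicate-!)
open import Data.Product using (∃; _×_; _,_; proj₁; proj₂)
open import Data.Sum using (_⊎_; inj₁; inj₂)
open import Data.Empty using (⊥-elim)
open import Function using (_∘_)
open import Relation.Binary.Definitions using (DecidableEquality)
open import Relation.Binary.PropositionalEquality
  using (_≡_; _≢_; refl; sym; trans; cong; cong₂; subst; subst₂; module ≡-Reasoning)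
open import Relation.Nullary using (¬_; Dec; yes; no)
open import Relation.Nullary.Decidable using (_×-dec_)
open import Relation.Unary using (Decidable)

module _ {A : Set} where

  ∈-─⁺ : ∀ {x y : A} {ys} (x∈ys : x ∈ ys) → y ∈ ys → y ≢ x → y ∈ (ys ─ x∈ys)
  ∈-─⁺ (here refl) (here refl) y≢x = ⊥-elim (y≢x refl)
  ∈-─⁺ (here _)    (there y∈)  _   = y∈
  ∈-─⁺ (there _)   (here refl) _   = here refl
  ∈-─⁺ (there x∈)  (there y∈)  y≢x = there (∈-─⁺ x∈ y∈ y≢x)

  Unique-⊆⇒length-≤ : ∀ {xs ys : List A} → Unique xs → xs ⊆ ys → length xs ≤ length ys
  Unique-⊆⇒length-≤ [] _ = z≤n
  Unique-⊆⇒length-≤ {x ∷ xs} {ys} (x∉xs ∷ xs!) xs⊆ys = begin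
      suc (length xs)          ≤⟨ s≤s (Unique-⊆⇒length-≤ xs! xs⊆ys─x) ⟩
      suc (length (ys ─ x∈ys)) ≡⟨ length-removeAt′ ys (index x∈ys) ⟨
      length ys                ∎
    where
    open ≤-Reasoning
    x∈ys = xs⊆ys (here refl)
    xs⊆ys─x : xs ⊆ (ys ─ x∈ys)
    xs⊆ys─x y∈xs = ∈-─⁺ x∈ys (xs⊆ys (there y∈xs)) (All.lookup x∉xs y∈xs ∘ sym)

  module _ {B : Set} (f : A → List B) where

    ∈-concatMap⁺′ : ∀ {x y xs} → x ∈ xs → y ∈ f x → y ∈ concatMap f xs
    ∈-concatMap⁺′ x∈ y∈ = ∈-concatMap⁺ f (lose x∈ y∈)

    length-concatMap-≤ : ∀ xs {b} → (∀ {x} → x ∈ xs → length (f x) ≤ b) →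
                         length (concatMap f xs) ≤ length xs * b
    length-concatMap-≤ []       _     = z≤n
    length-concatMap-≤ (x ∷ xs) {b} bound = begin
        length (f x ++ concatMap f xs)
          ≡⟨ length-++ (f x) ⟩
        length (f x) + length (concatMap f xs)
          ≤⟨ +-mono-≤ (bound (here refl)) (length-concatMap-≤ xs (λ x∈ → bound (there x∈))) ⟩
        b + length xs * b
          ∎
      where open ≤-Reasoning

  vecsIn : ∀ {d} → (Fin d → List A) → List (Vec A d)
  vecsIn {zero}  _   = [ [] ]
  vecsIn {suc d} xss = concatMap (λ x → List.map (x Vec.∷_) (vecsIn (xss ∘ suc))) (xss zero)

  ∈-vecsIn : ∀ {d} {xss : Fin d → List A} (v : Vec A d) →
             (∀ j → lookup v j ∈ xss j) → v ∈ vecsIn xss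
  ∈-vecsIn []      _  = here refl
  ∈-vecsIn (x ∷ v) v∈ =
    ∈-concatMap⁺′ _ (v∈ zero) (∈-map⁺ (x Vec.∷_) (∈-vecsIn v (v∈ ∘ suc)))

  length-vecsIn-≤ : ∀ {d} (xss : Fin d → List A) {b} → (∀ j → length (xss j) ≤ b) →
                    length (vecsIn xss) ≤ b ^ d
  length-vecsIn-≤ {zero}  _   _ = s≤s z≤n
  length-vecsIn-≤ {suc d} xss {b} bound = begin
      length (vecsIn xss)       ≤⟨ length-concatMap-≤ _ (xss zero) (λ {x} _ → length-tail x) ⟩
      length (xss zero) * b ^ d ≤⟨ *-monoˡ-≤ (b ^ d) (bound zero) ⟩
      b * b ^ d                 ∎
    where
    open ≤-Reasoning
    length-tail : ∀ x → length (List.map (x Vec.∷_) (vecsIn (xss ∘ suc))) ≤ b ^ d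
    length-tail x = ≤-trans (≤-reflexive (length-map (x Vec.∷_) (vecsIn (xss ∘ suc))))
                            (length-vecsIn-≤ (xss ∘ suc) (bound ∘ suc))

  combinations : (k : ℕ) → List A → List (Vec A k)
  combinations zero    _        = [ [] ]
  combinations (suc k) []       = []
  combinations (suc k) (x ∷ xs) = List.map (x Vec.∷_) (combinations k xs) ++ combinations (suc k) xs

  length-combinations : ∀ k xs → length (combinations k xs) ≡ length xs C k
  length-combinations zero    _        = refl
  length-combinations (suc k) []       = refl
  length-combinations (suc k) (x ∷ xs) = begin
      length (List.map (x Vec.∷_) (combinations k xs) ++ combinations (suc k) xs)
        ≡⟨ length-++ (List.map (x Vec.∷_) (combinations k xs)) ⟩
      length (List.map (x Vec.∷_) (combinations k xs)) + length (combinations (suc k) xs)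
        ≡⟨ cong₂ _+_ (trans (length-map (x Vec.∷_) (combinations k xs)) (length-combinations k xs))
                     (length-combinations (suc k) xs) ⟩
      length xs C k + length xs C suc k
        ≡⟨ nCk+nC[k+1]≡[n+1]C[k+1] (length xs) k ⟩
      suc (length xs) C suc k
        ∎
    where open ≡-Reasoning

  ∈-combinations-∷⁻ : ∀ {k x xs} {S : Vec A (suc k)} →
                      S ∈ combinations (suc k) (x ∷ xs) →
                      (∃ λ S′ → S ≡ x ∷ S′ × S′ ∈ combinations k xs) ⊎
                      S ∈ combinations (suc k) xs
  ∈-combinations-∷⁻ {k} {x} {xs} S∈ with ∈-++⁻ (List.map (x Vec.∷_) (combinations k xs)) S∈
  ... | inj₁ S∈head = let S′ , S′∈ , S≡ = ∈-map⁻ (x Vec.∷_) S∈head in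
                      inj₁ (S′ , S≡ , S′∈)
  ... | inj₂ S∈tail = inj₂ S∈tail

  ∈-combinations⁻ : ∀ {k xs} {S : Vec A k} → S ∈ combinations k xs →
                    ∀ a → lookup S a ∈ xs
  ∈-combinations⁻ {suc k} {x ∷ xs} S∈ a with ∈-combinations-∷⁻ S∈ | a
  ... | inj₁ (_ , refl , _)   | zero   = here refl
  ... | inj₁ (_ , refl , S′∈) | suc a′ = there (∈-combinations⁻ S′∈ a′)
  ... | inj₂ S∈′              | a′     = there (∈-combinations⁻ S∈′ a′)

  combinations-pairwise : ∀ {R : A → A → Set} {k xs} {S : Vec A k} → AllPairs R xs →
                          S ∈ combinations k xs →
                          ∀ a b → a Fin.< b → R (lookup S a) (lookup S b)
  combinations-pairwise {k = suc k} {x ∷ xs} (_ ∷ xs-pairwise) S∈ a b a<b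
    with ∈-combinations-∷⁻ S∈
  ... | inj₂ S∈′ = combinations-pairwise xs-pairwise S∈′ a b a<b
  combinations-pairwise {k = suc k} {x ∷ xs} (x-xs ∷ _) S∈ zero (suc b) _
    | inj₁ (_ , refl , S′∈) = All.lookup x-xs (∈-combinations⁻ S′∈ b)
  combinations-pairwise {k = suc k} {x ∷ xs} (_ ∷ xs-pairwise) S∈ (suc a) (suc b) (s≤s a<b)
    | inj₁ (_ , refl , S′∈) = combinations-pairwise xs-pairwise S′∈ a b a<b

  combination-satisfying : ∀ {P : A → Set} (P? : Decidable P) k xs →
                           k ≤ length (filter P? xs) →
                           ∃ λ S → S ∈ combinations k xs × ∀ a → P (lookup S a)
  combination-satisfying P? zero    xs       _ = [] , here refl , λ ()
  combination-satisfying P? (suc k) (x ∷ xs) k≤ with P? x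
  ... | yes Px = let S , S∈ , PS = combination-satisfying P? k xs (≤-pred k≤) in
        x ∷ S , ∈-++⁺ˡ (∈-map⁺ (x Vec.∷_) S∈) , λ { zero → Px ; (suc a) → PS a }
  ... | no _   = let S , S∈ , PS = combination-satisfying P? (suc k) xs k≤ in
        S , ∈-++⁺ʳ (List.map (x Vec.∷_) (combinations k xs)) S∈ , PS

length-allFin : ∀ n → length (allFin n) ≡ n
length-allFin n = length-tabulate {n = n} (λ i → i)

combinations-allFin-increasing : ∀ {k m} {S : Vec (Fin m) k} → S ∈ combinations k (allFin m) →
                                 Increasing (lookup S)
combinations-allFin-increasing = combinations-pairwise (tabulate⁺-< (λ i<j → i<j))

lookup-removeAt : ∀ {A : Set} {n} (v : Vec A (suc n)) i j →
                  lookup (removeAt v i) j ≡ lookup v (punchIn i j)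
lookup-removeAt (x ∷ v)     zero    j       = refl
lookup-removeAt (x ∷ y ∷ v) (suc i) zero    = refl
lookup-removeAt (x ∷ y ∷ v) (suc i) (suc j) = lookup-removeAt (y ∷ v) i j

_≟ₚ_ : ∀ {d n} → DecidableEquality (Point d n)
_≟ₚ_ = ≡-dec _≟ᶠ_

fromList : ∀ {d n} → List (Point d n) → Matrix d n
fromList xs = mkMatrix (deduplicate _≟ₚ_ xs) (deduplicate-! _≟ₚ_ xs)

∈-fromList⁺ : ∀ {d n} {x : Point d n} {xs} → x ∈ xs → x ∈ entries (fromList xs)
∈-fromList⁺ = ∈-deduplicate⁺ _≟ₚ_

∈-fromList⁻ : ∀ {d n} {x : Point d n} {xs} → x ∈ entries (fromList xs) → x ∈ xs
∈-fromList⁻ {xs = xs} = ∈-deduplicate⁻ _≟ₚ_ xs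

module _ {d k : ℕ} {P : Matrix d k} (perm : IsPermutation P) where

  entryAt : Fin d → Fin k → Point d k
  entryAt i v = proj₁ (proj₁ (perm i v))

  entryAt-∈ : ∀ i v → entryAt i v ∈ entries P
  entryAt-∈ i v = proj₁ (proj₂ (proj₁ (perm i v)))

  lookup-entryAt : ∀ i v → lookup (entryAt i v) i ≡ v
  lookup-entryAt i v = proj₂ (proj₂ (proj₁ (perm i v)))

  entryAt-lookup : ∀ {x} → x ∈ entries P → ∀ i → entryAt i (lookup x i) ≡ x
  entryAt-lookup x∈ i = proj₂ (perm i _) _ _ (entryAt-∈ i _) x∈ (lookup-entryAt i _) refl

  -- As P has exactly one entry in each hyperplane x_i = v, a coordinatewise
  -- monotone choice of images of its entries determines the increasing maps.
  contains-if-monotonically-realised :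
    ∀ {n} (M : Matrix d n) {R : Point d k → Point d n → Set} → (∀ x p → Dec (R x p)) →
    (∀ {x} → x ∈ entries P → Any (R x) (entries M)) →
    (∀ i {x y p q} → R x p → R y q →
       lookup x i Fin.< lookup y i → lookup p i Fin.< lookup q i) →
    Contains M P
  contains-if-monotonically-realised {n} M {R} R? realised monotone = g , g-increasing , g-maps
    where
    -- Choosing through any? makes the image independent of the proof of x ∈ P.
    choose : ∀ {x} → Dec (Any (R x) (entries M)) → x ∈ entries P →
             ∃ λ p → p ∈ entries M × R x p
    choose (yes r) _  = find r
    choose (no ¬r) x∈ = ⊥-elim (¬r (realised x∈))

    choose-irrelevant : ∀ {x} (r : Dec (Any (R x) (entries M))) (x∈ x∈′ : x ∈ entries P) →
                        proj₁ (choose r x∈) ≡ proj₁ (choose r x∈′)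
    choose-irrelevant (yes _) _  _ = refl
    choose-irrelevant (no ¬r) x∈ _ = ⊥-elim (¬r (realised x∈))

    image : ∀ {x} → x ∈ entries P → ∃ λ p → p ∈ entries M × R x p
    image {x} = choose (any? (R? x) (entries M))

    image-cong : ∀ {x y} → x ≡ y → (x∈ : x ∈ entries P) (y∈ : y ∈ entries P) →
                 proj₁ (image x∈) ≡ proj₁ (image y∈)
    image-cong {x} refl = choose-irrelevant (any? (R? x) (entries M))

    g : Fin d → Fin k → Fin n
    g i v = lookup (proj₁ (image (entryAt-∈ i v))) i

    g-increasing : ∀ i → Increasing (g i)
    g-increasing i a b a<b =
      monotone i (proj₂ (proj₂ (image (entryAt-∈ i a))))
                 (proj₂ (proj₂ (image (entryAt-∈ i b))))
        (subst₂ Fin._<_ (sym (lookup-entryAt i a)) (sym (lookup-entryAt i b)) a<b)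

    g-maps : ∀ x → x ∈ entries P → tabulate (λ i → g i (lookup x i)) ∈ entries M
    g-maps x x∈ = subst (_∈ entries M) (sym tabulate≡image) (proj₁ (proj₂ (image x∈)))
      where
      tabulate≡image : tabulate (λ i → g i (lookup x i)) ≡ proj₁ (image x∈)
      tabulate≡image = trans
        (tabulate-cong (λ i → cong (λ p → lookup p i) (image-cong (entryAt-lookup x∈ i) _ x∈)))
        (tabulate∘lookup _)

dropCoordinate : ∀ {d k} → Fin (suc d) → Matrix (suc d) k → Matrix d k
dropCoordinate i P = fromList (List.map (λ e → removeAt e i) (entries P))

dropCoordinate-isPermutation : ∀ {d k} {P : Matrix (suc d) k} i → IsPermutation P →
                               IsPermutation (dropCoordinate i P)
dropCoordinate-isPermutation {P = P} i perm j v =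
  (removeAt e i , ∈-fromList⁺ (∈-map⁺ _ (entryAt-∈ {P = P} perm j′ v)) ,
   trans (lookup-removeAt e i j) (lookup-entryAt {P = P} perm j′ v)) ,
  at-most-one
  where
  j′ = punchIn i j
  e = entryAt {P = P} perm j′ v
  at-most-one : ∀ r r′ → r ∈ entries (dropCoordinate i P) → r′ ∈ entries (dropCoordinate i P) →
                lookup r j ≡ v → lookup r′ j ≡ v → r ≡ r′
  at-most-one r r′ r∈ r′∈ r≡ r′≡
    with ∈-map⁻ _ (∈-fromList⁻ r∈) | ∈-map⁻ _ (∈-fromList⁻ r′∈)
  ... | x , x∈ , refl | y , y∈ , refl = cong (λ w → removeAt w i)
    (proj₂ (perm j′ v) x y x∈ y∈ (trans (sym (lookup-removeAt x i j)) r≡)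
                                 (trans (sym (lookup-removeAt y i j)) r′≡))

module BlockDecomposition (n₀ m : ℕ) where

  block : Fin (n₀ * m) → Fin n₀
  block x = proj₁ (remQuot {n₀} m x)

  offset : Fin (n₀ * m) → Fin m
  offset x = proj₂ (remQuot {n₀} m x)

  combine-block-offset : ∀ x → combine (block x) (offset x) ≡ x
  combine-block-offset = combine-remQuot {n₀} m

  combine-monoʳ-< : ∀ (t : Fin n₀) {s s′ : Fin m} → s Fin.< s′ →
                    combine t s Fin.< combine t s′
  combine-monoʳ-< t {s} {s′} s<s′ = subst₂ ℕ._<_ (sym (toℕ-combine t s)) (sym (toℕ-combine t s′))
    (+-monoʳ-< (m * toℕ t) s<s′)

  block-<⇒< : ∀ {x y} → block x Fin.< block y → x Fin.< y
  block-<⇒< {x} {y} bx<by = subst₂ Fin._<_ (combine-block-offset x) (combine-block-offset y)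
    (combine-monoˡ-< (offset x) (offset y) bx<by)

  offset-<⇒< : ∀ {x y} → block x ≡ block y → offset x Fin.< offset y → x Fin.< y
  offset-<⇒< {x} {y} bx≡by ox<oy = subst₂ Fin._<_ (combine-block-offset x) (combine-block-offset y)
    (subst (λ t → combine (block x) (offset x) Fin.< combine t (offset y)) bx≡by
      (combine-monoʳ-< (block x) ox<oy))

  blocks : ∀ {d} → Point d (n₀ * m) → Point d n₀
  blocks = Vec.map block

  offsets : ∀ {d} → Point d (n₀ * m) → Point d m
  offsets = Vec.map offset

  assemble : ∀ {d} → Point d n₀ → Point d m → Point d (n₀ * m)
  assemble = zipWith combine

  assemble-blocks-offsets : ∀ {d} (p : Point d (n₀ * m)) → assemble (blocks p) (offsets p) ≡ p
  assemble-blocks-offsets []      = refl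
  assemble-blocks-offsets (x ∷ p) = cong₂ _∷_ (combine-block-offset x) (assemble-blocks-offsets p)

  lookup-blocks : ∀ {d} {p : Point d (n₀ * m)} {β} → blocks p ≡ β →
                  ∀ j → block (lookup p j) ≡ lookup β j
  lookup-blocks {p = p} refl j = sym (lookup-map j block p)

  contraction : ∀ {d} → Matrix d (n₀ * m) → Matrix d n₀
  contraction M = fromList (List.map blocks (entries M))

  contraction-avoids : ∀ {d k} {P : Matrix d k} {M : Matrix d (n₀ * m)} →
                       IsPermutation P → Avoids M P → Avoids (contraction M) P
  contraction-avoids {d} {k} {P} {M} perm M-avoids (g , g-increasing , g-maps) =
    M-avoids (contains-if-monotonically-realised {P = P} perm M
      (λ x p → blocks p ≟ₚ image x) realised monotone)
    where
    image : Point d k → Point d n₀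
    image x = tabulate (λ j → g j (lookup x j))

    realised : ∀ {x} → x ∈ entries P → Any (λ p → blocks p ≡ image x) (entries M)
    realised {x} x∈ with ∈-map⁻ blocks (∈-fromList⁻ (g-maps x x∈))
    ... | p , p∈ , image≡ = lose p∈ (sym image≡)

    block-image : ∀ {x p} → blocks p ≡ image x →
                  ∀ j → block (lookup p j) ≡ g j (lookup x j)
    block-image p≡ j = trans (lookup-blocks p≡ j) (lookup∘tabulate _ j)

    monotone : ∀ j {x y p q} → blocks p ≡ image x → blocks q ≡ image y →
               lookup x j Fin.< lookup y j → lookup p j Fin.< lookup q j
    monotone j {x} {y} p≡ q≡ x<y = block-<⇒<
      (subst₂ Fin._<_ (sym (block-image {x} p≡ j)) (sym (block-image {y} q≡ j))
        (g-increasing j _ _ x<y))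

  Occupied : ∀ {d} → Matrix d (n₀ * m) → Point d n₀ → Fin d → Fin m → Set
  Occupied M β i s = Any (λ p → blocks p ≡ β × offset (lookup p i) ≡ s) (entries M)

  occupied? : ∀ {d} (M : Matrix d (n₀ * m)) β i s → Dec (Occupied M β i s)
  occupied? M β i s =
    any? (λ p → (blocks p ≟ₚ β) ×-dec (offset (lookup p i) ≟ᶠ s)) (entries M)

  Wide : ∀ {d k} → Matrix (suc d) (n₀ * m) → Fin (suc d) → Fin n₀ → Vec (Fin m) k →
         Point d n₀ → Set
  Wide M i t S q = ∀ a → Occupied M (insertAt q i t) i (lookup S a)

  wide? : ∀ {d k} (M : Matrix (suc d) (n₀ * m)) i t (S : Vec (Fin m) k) q → Dec (Wide M i t S q)
  wide? M i t S q = all? (λ a → occupied? M (insertAt q i t) i (lookup S a))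

  blocksWithout : ∀ {d} → Matrix (suc d) (n₀ * m) → Fin (suc d) → List (Point d n₀)
  blocksWithout M i = List.map (λ p → removeAt (blocks p) i) (entries M)

  wideLayer : ∀ {d k} → Matrix (suc d) (n₀ * m) → Fin (suc d) → Fin n₀ → Vec (Fin m) k →
              Matrix d n₀
  wideLayer M i t S = fromList (filter (wide? M i t S) (blocksWithout M i))

  wideLayer-avoids : ∀ {d k} {P : Matrix (suc d) k} {M : Matrix (suc d) (n₀ * m)}
                     i t {S : Vec (Fin m) k} →
                     Increasing (lookup S) → IsPermutation P → Avoids M P →
                     Avoids (wideLayer M i t S) (dropCoordinate i P)
  wideLayer-avoids {d} {k} {P} {M} i t {S} S-increasing perm M-avoids (g , g-increasing , g-maps) =
    M-avoids (contains-if-monotonically-realised {P = P} perm M R? realised monotone)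
    where
    image : Point (suc d) k → Point (suc d) n₀
    image x = insertAt (tabulate (λ j → g j (lookup (removeAt x i) j))) i t

    R : Point (suc d) k → Point (suc d) (n₀ * m) → Set
    R x p = blocks p ≡ image x × offset (lookup p i) ≡ lookup S (lookup x i)

    R? : ∀ x p → Dec (R x p)
    R? x p = (blocks p ≟ₚ image x) ×-dec (offset (lookup p i) ≟ᶠ lookup S (lookup x i))

    realised : ∀ {x} → x ∈ entries P → Any (R x) (entries M)
    realised {x} x∈ = wide (lookup x i)
      where
      image∈ = g-maps (removeAt x i) (∈-fromList⁺ (∈-map⁺ (λ e → removeAt e i) x∈))
      wide = proj₂ (∈-filter⁻ (wide? M i t S) {xs = blocksWithout M i} (∈-fromList⁻ image∈))

    lookup-image-≢ : ∀ x {j} (i≢j : i ≢ j) → lookup (image x) j ≡ g (punchOut i≢j) (lookup x j)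
    lookup-image-≢ x {j} i≢j = begin
        lookup (image x) j
          ≡⟨ cong (lookup (image x)) (punchIn-punchOut i≢j) ⟨
        lookup (image x) (punchIn i j′)
          ≡⟨ insertAt-punchIn _ i t j′ ⟩
        lookup (tabulate (λ j → g j (lookup (removeAt x i) j))) j′
          ≡⟨ lookup∘tabulate _ j′ ⟩
        g j′ (lookup (removeAt x i) j′)
          ≡⟨ cong (g j′) (removeAt-punchOut x i≢j) ⟩
        g j′ (lookup x j)
          ∎
      where
      open ≡-Reasoning
      j′ = punchOut i≢j

    block-at-i : ∀ {x p} → blocks p ≡ image x → block (lookup p i) ≡ t
    block-at-i p≡ = trans (lookup-blocks p≡ i) (insertAt-lookup _ i t)

    monotone : ∀ j {x y p q} → R x p → R y q →
               lookup x j Fin.< lookup y j → lookup p j Fin.< lookup q j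
    monotone j {x} {y} (p≡ , p-offset) (q≡ , q-offset) x<y with i ≟ᶠ j
    ... | yes refl = offset-<⇒< (trans (block-at-i {x} p≡) (sym (block-at-i {y} q≡)))
                       (subst₂ Fin._<_ (sym p-offset) (sym q-offset) (S-increasing _ _ x<y))
    ... | no i≢j = block-<⇒< (subst₂ Fin._<_
                     (sym (trans (lookup-blocks p≡ j) (lookup-image-≢ x i≢j)))
                     (sym (trans (lookup-blocks q≡ j) (lookup-image-≢ y i≢j)))
                     (g-increasing (punchOut i≢j) _ _ x<y))

  occupiedOffsets : ∀ {d} → Matrix d (n₀ * m) → Point d n₀ → Fin d → List (Fin m)
  occupiedOffsets M β j = filter (occupied? M β j) (allFin m)

  offset-∈-occupiedOffsets : ∀ {d} {M : Matrix d (n₀ * m)} {p} → p ∈ entries M →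
                             ∀ j → offset (lookup p j) ∈ occupiedOffsets M (blocks p) j
  offset-∈-occupiedOffsets {M = M} {p} p∈ j =
    ∈-filter⁺ (occupied? M (blocks p) j) (∈-allFin _) (lose p∈ (refl , refl))

  thin-or-wide : ∀ {d} (M : Matrix d (n₀ * m)) k β →
                 (∀ j → length (occupiedOffsets M β j) ≤ k ∸ 1) ⊎
                 (∃ λ i → ∃ λ S → S ∈ combinations k (allFin m) ×
                                  ∀ a → Occupied M β i (lookup S a))
  thin-or-wide M k β with all? (λ j → length (occupiedOffsets M β j) ≤? k ∸ 1)
  ... | yes thin = inj₁ thin
  ... | no ¬thin with ¬∀⟶∃¬ _ _ (λ j → length (occupiedOffsets M β j) ≤? k ∸ 1) ¬thin
  ... | i , ¬≤ =
    let S , S∈ , occupied = combination-satisfying (occupied? M β i) k (allFin m) (≰∸1⇒≥ k ¬≤) in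
    inj₂ (i , S , S∈ , occupied)
    where
    ≰∸1⇒≥ : ∀ k {ℓ} → ¬ ℓ ≤ k ∸ 1 → k ≤ ℓ
    ≰∸1⇒≥ zero    _  = z≤n
    ≰∸1⇒≥ (suc k) ℓ≰ = ≰⇒> ℓ≰

  pointsIn : ∀ {d} → List (Point d n₀) → (Point d n₀ → Fin d → List (Fin m)) →
             List (Point d (n₀ * m))
  pointsIn βs allowed = concatMap (λ β → List.map (assemble β) (vecsIn (allowed β))) βs

  ∈-pointsIn : ∀ {d} {βs} {allowed : Point d n₀ → Fin d → List (Fin m)} {p} → blocks p ∈ βs →
               (∀ j → offset (lookup p j) ∈ allowed (blocks p) j) → p ∈ pointsIn βs allowed
  ∈-pointsIn {allowed = allowed} {p} β∈ offsets∈ = ∈-concatMap⁺′ _ β∈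
    (subst (_∈ List.map (assemble (blocks p)) (vecsIn (allowed (blocks p))))
      (assemble-blocks-offsets p)
      (∈-map⁺ (assemble (blocks p)) (∈-vecsIn (offsets p) λ j →
        subst (_∈ allowed (blocks p) j) (sym (lookup-map j offset p)) (offsets∈ j))))

  length-pointsIn-≤ : ∀ {d} βs (allowed : Point d n₀ → Fin d → List (Fin m)) {b} →
                      (∀ β j → length (allowed β j) ≤ b) →
                      length (pointsIn βs allowed) ≤ length βs * b ^ d
  length-pointsIn-≤ βs allowed bound = length-concatMap-≤ _ βs λ {β} _ →
    ≤-trans (≤-reflexive (length-map (assemble β) (vecsIn (allowed β))))
            (length-vecsIn-≤ (allowed β) (bound β))

  wideBlocksAt : ∀ {d k} → Matrix (suc d) (n₀ * m) → Fin (suc d) → Fin n₀ → Vec (Fin m) k →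
                 List (Point (suc d) n₀)
  wideBlocksAt M i t S = List.map (λ q → insertAt q i t) (entries (wideLayer M i t S))

  wideBlocksIn : ∀ {d} → Matrix (suc d) (n₀ * m) → ℕ → Fin (suc d) → List (Point (suc d) n₀)
  wideBlocksIn M k i =
    concatMap (λ t → concatMap (wideBlocksAt M i t) (combinations k (allFin m))) (allFin n₀)

  wideBlocks : ∀ {d} → Matrix (suc d) (n₀ * m) → ℕ → List (Point (suc d) n₀)
  wideBlocks {d} M k = concatMap (wideBlocksIn M k) (allFin (suc d))

  ∈-wideBlocks : ∀ {d k} {M : Matrix (suc d) (n₀ * m)} {p i} {S : Vec (Fin m) k} →
                 p ∈ entries M → S ∈ combinations k (allFin m) →
                 (∀ a → Occupied M (blocks p) i (lookup S a)) →
                 blocks p ∈ wideBlocks M k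
  ∈-wideBlocks {M = M} {p} {i} {S} p∈ S∈ occupied =
    ∈-concatMap⁺′ _ (∈-allFin i) (∈-concatMap⁺′ _ (∈-allFin t) (∈-concatMap⁺′ _ S∈
      (subst (_∈ wideBlocksAt M i t S) (insertAt-removeAt β i) (∈-map⁺ (λ q → insertAt q i t) q∈))))
    where
    β = blocks p
    t = lookup β i
    q∈ : removeAt β i ∈ entries (wideLayer M i t S)
    q∈ = ∈-fromList⁺ (∈-filter⁺ (wide? M i t S) (∈-map⁺ (λ p → removeAt (blocks p) i) p∈) λ a →
      subst (λ γ → Occupied M γ i (lookup S a)) (sym (insertAt-removeAt β i)) (occupied a))

  length-wideBlocks-≤ : ∀ {d} (M : Matrix (suc d) (n₀ * m)) k {c} →
                        (∀ i t {S} → S ∈ combinations k (allFin m) →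
                           size (wideLayer M i t S) ≤ c) →
                        length (wideBlocks M k) ≤ suc d * (n₀ * ((m C k) * c))
  length-wideBlocks-≤ {d} M k {c} bound =
    concatMap-≤ (wideBlocksIn M k) (allFin (suc d)) (length-allFin (suc d)) λ {i} _ →
    concatMap-≤ (λ t → concatMap (wideBlocksAt M i t) (combinations k (allFin m))) (allFin n₀)
      (length-allFin n₀) λ {t} _ →
    concatMap-≤ (wideBlocksAt M i t) (combinations k (allFin m))
      (trans (length-combinations k (allFin m)) (cong (_C k) (length-allFin m))) λ {S} S∈ →
    ≤-trans (≤-reflexive (length-map (λ q → insertAt q i t) (entries (wideLayer M i t S))))
            (bound i t S∈)
    where
    concatMap-≤ : ∀ {A B : Set} (f : A → List B) xs {ℓ b} → length xs ≡ ℓ →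
                  (∀ {x} → x ∈ xs → length (f x) ≤ b) → length (concatMap f xs) ≤ ℓ * b
    concatMap-≤ f xs refl = length-concatMap-≤ f xs

  -- Truncating to k-1 offsets changes nothing in a thin block and makes every
  -- block contribute at most (k-1)^d points.
  thinOffsets : ∀ {d} → Matrix d (n₀ * m) → ℕ → Point d n₀ → Fin d → List (Fin m)
  thinOffsets M k β j = take (k ∸ 1) (occupiedOffsets M β j)

  anyOffset : ∀ {d} → Point d n₀ → Fin d → List (Fin m)
  anyOffset _ _ = allFin m

  thinPoints : ∀ {d} → Matrix d (n₀ * m) → ℕ → List (Point d (n₀ * m))
  thinPoints M k = pointsIn (entries (contraction M)) (thinOffsets M k)

  widePoints : ∀ {d} → Matrix (suc d) (n₀ * m) → ℕ → List (Point (suc d) (n₀ * m))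
  widePoints M k = pointsIn (wideBlocks M k) anyOffset

  length-thinPoints-≤ : ∀ {d} (M : Matrix d (n₀ * m)) k →
                        length (thinPoints M k) ≤ size (contraction M) * (k ∸ 1) ^ d
  length-thinPoints-≤ M k = length-pointsIn-≤ (entries (contraction M)) (thinOffsets M k)
    (λ β j → ≤-trans (≤-reflexive (length-take (k ∸ 1) _)) (m⊓n≤m _ _))

  length-widePoints-≤ : ∀ {d} (M : Matrix (suc d) (n₀ * m)) k →
                        length (widePoints M k) ≤ length (wideBlocks M k) * m ^ suc d
  length-widePoints-≤ M k = length-pointsIn-≤ (wideBlocks M k) anyOffset
    (λ _ _ → ≤-reflexive (length-allFin m))

  ⊆-thinPoints-++-widePoints : ∀ {d} (M : Matrix (suc d) (n₀ * m)) k →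
                               entries M ⊆ thinPoints M k ++ widePoints M k
  ⊆-thinPoints-++-widePoints M k {p} p∈ with thin-or-wide M k (blocks p)
  ... | inj₁ thin = ∈-++⁺ˡ {ys = widePoints M k}
          (∈-pointsIn {allowed = thinOffsets M k} (∈-fromList⁺ (∈-map⁺ blocks p∈)) λ j →
            subst (offset (lookup p j) ∈_) (sym (take-all (k ∸ 1) _ (thin j)))
              (offset-∈-occupiedOffsets {M = M} p∈ j))
  ... | inj₂ (i , S , S∈ , occupied) = ∈-++⁺ʳ (thinPoints M k)
          (∈-pointsIn {allowed = anyOffset} (∈-wideBlocks {M = M} p∈ S∈ occupied)
            (λ _ → ∈-allFin _))

  avoiding-size-≤ : ∀ {d k b c} {P : Matrix (suc d) k} {M : Matrix (suc d) (n₀ * m)} →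
                    IsPermutation P → Avoids M P →
                    (∀ (N : Matrix (suc d) n₀) → Avoids N P → size N ≤ b) →
                    (∀ i (L : Matrix d n₀) → Avoids L (dropCoordinate i P) → size L ≤ c) →
                    size M ≤ (k ∸ 1) ^ suc d * b + suc d * n₀ * m ^ suc d * (m C k) * c
  avoiding-size-≤ {d} {k} {b} {c} {P} {M} perm M-avoids bound-b bound-c = begin
      size M
        ≤⟨ Unique-⊆⇒length-≤ (unique M) (⊆-thinPoints-++-widePoints M k) ⟩
      length (thinPoints M k ++ widePoints M k)
        ≡⟨ length-++ (thinPoints M k) ⟩
      length (thinPoints M k) + length (widePoints M k)
        ≤⟨ +-mono-≤ (length-thinPoints-≤ M k) (length-widePoints-≤ M k) ⟩
      size (contraction M) * (k ∸ 1) ^ suc d + length (wideBlocks M k) * m ^ suc d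
        ≤⟨ +-mono-≤ (*-monoˡ-≤ _ (bound-b (contraction M)
                                    (contraction-avoids {P = P} {M} perm M-avoids)))
                    (*-monoˡ-≤ _ (length-wideBlocks-≤ M k wideLayer-≤)) ⟩
      b * (k ∸ 1) ^ suc d + suc d * (n₀ * ((m C k) * c)) * m ^ suc d
        ≡⟨ rearrange b ((k ∸ 1) ^ suc d) (suc d) n₀ (m C k) c (m ^ suc d) ⟩
      (k ∸ 1) ^ suc d * b + suc d * n₀ * m ^ suc d * (m C k) * c
        ∎
    where
    open ≤-Reasoning

    wideLayer-≤ : ∀ i t {S} → S ∈ combinations k (allFin m) → size (wideLayer M i t S) ≤ c
    wideLayer-≤ i t {S} S∈ = bound-c i (wideLayer M i t S)
      (wideLayer-avoids {P = P} {M} i t {S} (combinations-allFin-increasing S∈) perm M-avoids)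

    rearrange : ∀ b X D n Cmk c Y → b * X + D * (n * (Cmk * c)) * Y ≡ X * b + D * n * Y * Cmk * c
    rearrange = solve-∀

-- The argument only needs d ≥ 1.
lemma4 : (d k m n₀ : ℕ) → 2 ≤ d →
    (a b c : ℕ) → IsF (m * n₀) k d a → IsF n₀ k d b → IsF n₀ k (d ∸ 1) c →
      a ≤ (k ∸ 1) ^ d * b + d * n₀ * m ^ d * (m C k) * c
lemma4 (suc d) k m n₀ (s≤s _) a b c F-a (_ , bound-b) (_ , bound-c)
  with (P , M , perm , M-avoids , refl) , _ ← subst (λ N → IsF N k (suc d) a) (*-comm m n₀) F-a
  = BlockDecomposition.avoiding-size-≤ n₀ m {P = P} {M} perm M-avoids
      (λ N → bound-b P N perm)
      (λ i L → bound-c (dropCoordinate i P) L (dropCoordinate-isPermutation {P = P} i perm))
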